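{- Let $n,d\in\mathbb{N}$ with $n>d$. There exists a regular $*$-irreducible $(n-d)$-domino tiling of the box $[0,2]^n$ if and only if $n\in\{d+1,d+2,\dots,2^d-1\}$.
   Context: For integers $n>d\geq 1$, an $(n-d)$-domino is a box $I_1\times\cdots\times I_n\subset[0,2]^n$ such that for some $N\subset[n]$ with $|N|=d$ we have $I_j\in\{[0,1],[1,2]\}$ for $j\in N$ and $I_i=[0,2]$ for $i\in[n]\setminus N$. Such a domino is identified with the word $u\in\{0,1,*\}^n$ where $u_j=0$ if $I_j=[0,1]$, $u_j=1$ if $I_j=[1,2]$, and $u_j=*$ if $I_j=[0,2]$. A family of $(n-d)$-dominoes is a tiling of $[0,2]^n$ if the interiors of any two distinct members are disjoint and their union is $[0,2]^n$ (such a tiling has $2^d$ members); we regard it as a set $D\subset\{0,1,*\}^n$ of words. A tiling $D$ is regular if there is a partition $[n]=N_1\,\dot\cup\cdots\dot\cup\,N_d\,\dot\cup\, N^*$ ($N^*$ possibly empty) such that: ($\alpha$) for each $i\in[d]$, $N_i$ is nonempty and the set $\{u|_{N_i}\colon u\in D\}$ of restrictions of the words of $D$ to the positions in $N_i$ (read in increasing order) is exactly the set of all words of length $|N_i|$ over $\{0,1,*\}$ having exactly one entry different from $*$ (i.e. $\{\delta*\cdots*,\ *\delta*\cdots*,\dots,*\cdots*\delta\colon \delta\in\{0,1\}\}$); ($\beta$) $u_j=*$ for every $u\in D$ and every $j\in N^*$. A tiling $D$ is $*$-irreducible if there is no $j\in[n]$ with $u_j=*$ for all $u\in D$. -}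

module Defs where

open import Data.Nat using (ℕ; zero; suc; _+_; _≤_; _<_; _^_; _∸_)
open import Data.Fin as Fin using (Fin; zero; suc)
open import Data.Bool using (Bool; true; false; if_then_else_)
open import Data.Maybe using (Maybe; just; nothing)
open import Data.Vec using (Vec; []; _∷_; lookup; toList)
open import Data.List using (List; []; _∷_; length)
open import Data.List.Relation.Unary.All using (All)
open import Data.List.Relation.Unary.Any using (Any)
open import Data.List.Relation.Unary.AllPairs using (AllPairs)
open import Data.List.Membership.Propositional using (_∈_)
open import Data.Product using (Σ; ∃; _×_)
open import Data.Sum using (_⊎_)
open import Relation.Nullary using (¬_; does)
open import Relation.Binary.PropositionalEquality using (_≡_)

-- Letters of domino words: s0 ~ [0,1], s1 ~ [1,2], star ~ [0,2].
data Sym : Set where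
  s0 s1 star : Sym

Word : ℕ → Set
Word n = Vec Sym n

nonStar : Sym → ℕ
nonStar star = 0
nonStar s0   = 1
nonStar s1   = 1

nonStarCount : List Sym → ℕ
nonStarCount []       = 0
nonStarCount (x ∷ xs) = nonStar x + nonStarCount xs

-- u is an (n-d)-domino: exactly d entries different from *
IsDomino : (n d : ℕ) → Word n → Set
IsDomino n d u = nonStarCount (toList u) ≡ d

-- interiors of the boxes u and v are disjoint: in some coordinate one is
-- [0,1] and the other is [1,2]
DisjointInteriors : {n : ℕ} → Word n → Word n → Set
DisjointInteriors {n} u v =
  ∃ λ (j : Fin n) → (lookup u j ≡ s0 × lookup v j ≡ s1) ⊎ (lookup u j ≡ s1 × lookup v j ≡ s0)

-- unit cells of [0,2]^n are indexed by x ∈ {0,1}^n (false ~ [0,1], true ~ [1,2])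
bitSym : Bool → Sym
bitSym false = s0
bitSym true  = s1

Covers : {n : ℕ} → Vec Bool n → Word n → Set
Covers {n} x u = (j : Fin n) → lookup u j ≡ star ⊎ lookup u j ≡ bitSym (lookup x j)

-- D (a finite set of words, as a list of distinct words) is an (n-d)-domino tiling of [0,2]^n.
-- Pairwise disjoint interiors (which forces distinctness of list entries) and
-- union = [0,2]^n (equivalently every unit cell is contained in some member).
IsTiling : (n d : ℕ) → List (Word n) → Set
IsTiling n d D =
  All (IsDomino n d) D
  × AllPairs DisjointInteriors D
  × ((x : Vec Bool n) → Any (Covers x) D)

restrict : {n : ℕ} → (Fin n → Bool) → Word n → List Sym
restrict {zero}  p []      = []
restrict {suc n} p (x ∷ u) =
  if p zero then x ∷ restrict (λ j → p (suc j)) u else restrict (λ j → p (suc j)) u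

countSel : {n : ℕ} → (Fin n → Bool) → ℕ
countSel {zero}  p = 0
countSel {suc n} p = (if p zero then 1 else 0) + countSel (λ j → p (suc j))

-- a partition [n] = N_1 ∪ ... ∪ N_d ∪ N* is encoded by f : Fin n → Maybe (Fin d):
-- j ∈ N_i iff f j ≡ just i, and j ∈ N* iff f j ≡ nothing.
inBlock : {d : ℕ} → Maybe (Fin d) → Fin d → Bool
inBlock nothing  i = false
inBlock (just k) i = does (k Fin.≟ i)

OneNonStarWord : ℕ → List Sym → Set
OneNonStarWord m w = length w ≡ m × nonStarCount w ≡ 1

IsRegular : (n d : ℕ) → List (Word n) → Set
IsRegular n d D =
  Σ (Fin n → Maybe (Fin d)) λ f →
    ((i : Fin d) →
      let p = λ (j : Fin n) → inBlock (f j) i in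
        (∃ λ (j : Fin n) → f j ≡ just i)
        × All (λ u → OneNonStarWord (countSel p) (restrict p u)) D
        × ((w : List Sym) → OneNonStarWord (countSel p) w →
             ∃ λ u → u ∈ D × restrict p u ≡ w))
    × ((j : Fin n) → f j ≡ nothing → All (λ u → lookup u j ≡ star) D)

StarIrreducible : (n : ℕ) → List (Word n) → Set
StarIrreducible n D = ¬ (∃ λ (j : Fin n) → All (λ u → lookup u j ≡ star) D)

{-# OPTIONS --safe #-}
-- Necessity. Index the unit cells of [0,2]^n by x ∈ {0,1}^n and let χ_S(x) = ∏_{j∈S} (-1)^(x_j).
-- Summing χ_S over a box u gives vol(u) · ∏_{j∈S} a(u_j), where vol(u) = 2^(number of stars)
-- and a(0) = 1, a(1) = -1, a(*) = 0. As D partitions the cube,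
-- ∑_x χ_S(x) = ∑_{u∈D} vol(u) · ∏_{j∈S} a(u_j). For S = ∅ this gives |D| = 2^d; for S = {j}
-- and S = {i,j} it says that the n + 1 vectors 1 and (a(u_j))_{u∈D} are pairwise orthogonal
-- for the vol-weighted inner product on ℤ^D. *-irreducibility makes them nonzero, so n + 1 ≤ 2^d.
--
-- Sufficiency. Take a regular *-irreducible tiling D of dimension n with d blocks and
-- 1 ≤ m ≤ 2^d. Label the dominoes of D onto [m], then replace each u, labelled c, by the two
-- words (δ at c, * at the other m - 1 new positions) ++ u, δ ∈ {0,1}. The new positions form
-- one more block. Starting from the empty word, block sizes 1 ≤ m_i ≤ 2^(i-1) reach every n
-- with d ≤ n < 2^d.
module Submission where

open import Defs
open import Data.Bool using (Bool; true; false; if_then_else_)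
open import Data.Empty using (⊥; ⊥-elim)
open import Data.Fin as Fin using (Fin; zero; suc; toℕ; punchIn; _↑ˡ_; _↑ʳ_)
import Data.Fin.Properties as FinP
open import Data.List as List using (List; []; _∷_; length)
import Data.List.Properties as ListP
open import Data.List.Membership.Propositional using (_∈_; find; lose)
open import Data.List.Membership.Propositional.Properties using (∈-lookup)
open import Data.List.Relation.Unary.All as All using (All; []; _∷_)
open import Data.List.Relation.Unary.All.Properties using (¬All⇒Any¬)
open import Data.List.Relation.Unary.Any as Any using (Any; here; there)
open import Data.List.Relation.Unary.Any.Properties using (lookup-index)
open import Data.List.Relation.Unary.AllPairs using (AllPairs; []; _∷_)
open import Data.Maybe as Maybe using (Maybe; just; nothing)
open import Data.Nat as ℕ using (ℕ; zero; suc; z≤n; s≤s)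
import Data.Nat.Properties as ℕP
open import Data.Product using (Σ; ∃; _×_; _,_; proj₁; proj₂)
open import Data.Sum using (_⊎_; inj₁; inj₂; [_,_]′)
open import Data.Unit using (⊤; tt)
open import Data.Vec as Vec using (Vec; []; _∷_; lookup; toList; _[_]≔_)
import Data.Vec.Properties as VecP
import Data.Vec.Functional as Vector
import Data.Vec.Functional.Properties as VectorP
open import Function using (_∘_; id; const)
open import Function.Bundles using (_⇔_; mk⇔)
open import Relation.Binary.PropositionalEquality
open import Relation.Nullary using (Dec; yes; no; contradiction)

SplitsEveryCoordinate : (n : ℕ) → List (Word n) → Set
SplitsEveryCoordinate n D = (j : Fin n) → Any (λ u → lookup u j ≢ star) D

star? : ∀ s → Dec (s ≡ star)
star? star = yes refl
star? s0   = no λ ()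
star? s1   = no λ ()

starIrreducible⇒splits : ∀ {n} {D : List (Word n)} → StarIrreducible n D → SplitsEveryCoordinate n D
starIrreducible⇒splits {D = D} irreducible j = ¬All⇒Any¬ (λ u → star? (lookup u j)) D (λ all-star → irreducible (j , all-star))

splits⇒starIrreducible : ∀ {n} {D : List (Word n)} → SplitsEveryCoordinate n D → StarIrreducible n D
splits⇒starIrreducible splits (j , all-star) = All.lookupWith (λ u≡star u≢star → u≢star u≡star) all-star (splits j)

module CharacterSums where

  open import Data.Integer as ℤ using (ℤ; +_; 0ℤ; 1ℤ; _+_; _*_; _≤_; _<_; +≤+; +<+; -[1+_]; +[1+_])
  import Data.Integer.Properties as ℤP
  open import Data.Integer.Tactic.RingSolver using (solve-∀)
  open import Data.Fin.Subset as Subset using (Subset; ⁅_⁆; _∪_; Nonempty)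
  open import Data.Fin.Subset.Properties using (x∈⁅x⁆; x∈p∪q⁺; ∪-identityˡ; ∪-identityʳ)
  open import Relation.Binary.Definitions using (tri<; tri≈; tri>)
  open import Algebra.Properties.Semiring.Sum ℤP.+-*-semiring
  open import Algebra.Properties.CommutativeMonoid.Sum ℤP.*-1-commutativeMonoid
    using () renaming (sum to product; sum-remove to product-remove)

  sum-mono-≤ : ∀ {n} {f g : Fin n → ℤ} → (∀ i → f i ≤ g i) → sum f ≤ sum g
  sum-mono-≤ {zero}  f≤g = ℤP.≤-refl
  sum-mono-≤ {suc n} f≤g = ℤP.+-mono-≤ (f≤g zero) (sum-mono-≤ (f≤g ∘ suc))

  sum-nonNeg : ∀ {n} {f : Fin n → ℤ} → (∀ i → 0ℤ ≤ f i) → 0ℤ ≤ sum f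
  sum-nonNeg {n} {f} 0≤f = subst (_≤ sum f) (sum-replicate-zero n) (sum-mono-≤ 0≤f)

  sum-zero : ∀ {n} {f : Fin n → ℤ} → (∀ i → f i ≡ 0ℤ) → sum f ≡ 0ℤ
  sum-zero {n} f≡0 = trans (sum-cong-≗ f≡0) (sum-replicate-zero n)

  term≤sum : ∀ {n} {f : Fin n → ℤ} → (∀ i → 0ℤ ≤ f i) → ∀ k → f k ≤ sum f
  term≤sum {suc n} {f} 0≤f k = begin
    f k                                ≡⟨ ℤP.+-identityʳ (f k) ⟨
    f k + 0ℤ                           ≤⟨ ℤP.+-monoʳ-≤ (f k) (sum-nonNeg (0≤f ∘ punchIn k)) ⟩
    f k + sum (Vector.removeAt f k)    ≡⟨ sum-remove f ⟨
    sum f                              ∎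
    where open ℤP.≤-Reasoning

  sum-single : ∀ {n} (f : Fin n → ℤ) k → (∀ i → i ≢ k → f i ≡ 0ℤ) → sum f ≡ f k
  sum-single {suc n} f k others≡0 = begin
    sum f                              ≡⟨ sum-remove f ⟩
    f k + sum (Vector.removeAt f k)    ≡⟨ cong (_+_ (f k)) (sum-zero (λ i → others≡0 (punchIn k i) (FinP.punchInᵢ≢i k i))) ⟩
    f k + 0ℤ                           ≡⟨ ℤP.+-identityʳ (f k) ⟩
    f k                                ∎
    where open ≡-Reasoning

  sum-const : ∀ n c → ∑[ i < n ] c ≡ + n * c
  sum-const zero    c = sym (ℤP.*-zeroˡ c)
  sum-const (suc n) c = trans (cong (_+_ c) (sum-const n c)) (sym (ℤP.suc-* (+ n) c))

  *-nonNeg : ∀ {a b} → 0ℤ ≤ a → 0ℤ ≤ b → 0ℤ ≤ a * b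
  *-nonNeg {+ a} {+ b} _ _ = subst (0ℤ ≤_) (ℤP.pos-* a b) (+≤+ z≤n)

  *-pos : ∀ {a b} → 0ℤ < a → 0ℤ < b → 0ℤ < a * b
  *-pos {a} {b} 0<a 0<b = subst (_< a * b) (ℤP.*-zeroˡ b) (ℤP.*-monoʳ-<-pos b {{ℤ.positive 0<b}} 0<a)

  square-nonNeg : ∀ a → 0ℤ ≤ a * a
  square-nonNeg (+ a)    = subst (0ℤ ≤_) (ℤP.pos-* a a) (+≤+ z≤n)
  square-nonNeg -[1+ a ] = +≤+ z≤n

  square-pos : ∀ {a} → a ≢ 0ℤ → 0ℤ < a * a
  square-pos {+ zero}   a≢0 = contradiction refl a≢0
  square-pos {+[1+ a ]} _   = +<+ (s≤s z≤n)
  square-pos { -[1+ a ]} _  = +<+ (s≤s z≤n)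

  product-pos : ∀ {n} {f : Fin n → ℤ} → (∀ i → 0ℤ < f i) → 0ℤ < product f
  product-pos {zero}  0<f = +<+ (s≤s z≤n)
  product-pos {suc n} 0<f = *-pos (0<f zero) (product-pos (0<f ∘ suc))

  *-cancelʳ-square : ∀ a {b t} → 0ℤ ≤ b → 0ℤ ≤ t → a * t * t ≤ b * t → a * t ≤ b
  *-cancelʳ-square a {b} {t} 0≤b 0≤t at²≤bt with ℤP.<-cmp 0ℤ t
  ... | tri< 0<t _ _ = ℤP.*-cancelʳ-≤-pos (a * t) b t {{ℤ.positive 0<t}} at²≤bt
  ... | tri≈ _ refl _ = subst (_≤ b) (sym (ℤP.*-zeroʳ a)) 0≤b
  ... | tri> _ _ t<0 = contradiction 0≤t (ℤP.<⇒≱ t<0)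

  module WeightedInnerProduct {L : ℕ} (W : Fin L → ℤ) (W≥0 : ∀ e → 0ℤ ≤ W e) where

    ⟪_,_⟫ : (Fin L → ℤ) → (Fin L → ℤ) → ℤ
    ⟪ x , y ⟫ = ∑[ e < L ] (W e * x e * y e)

    ⟪⟫-comm : ∀ x y → ⟪ x , y ⟫ ≡ ⟪ y , x ⟫
    ⟪⟫-comm x y = sum-cong-≗ λ e → swap (W e) (x e) (y e)
      where
      swap : ∀ w a b → w * a * b ≡ w * b * a
      swap = solve-∀

    ⟪x,x⟫-term-nonNeg : ∀ (x : Fin L → ℤ) e → 0ℤ ≤ W e * x e * x e
    ⟪x,x⟫-term-nonNeg x e = subst (0ℤ ≤_) (sym (ℤP.*-assoc (W e) (x e) (x e))) (*-nonNeg (W≥0 e) (square-nonNeg (x e)))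

    ⟪x,x⟫>0 : (∀ e → 0ℤ < W e) → ∀ x e → x e ≢ 0ℤ → 0ℤ < ⟪ x , x ⟫
    ⟪x,x⟫>0 W>0 x e xe≢0 = ℤP.<-≤-trans
      (subst (0ℤ <_) (sym (ℤP.*-assoc (W e) (x e) (x e))) (*-pos (W>0 e) (square-pos xe≢0)))
      (term≤sum (⟪x,x⟫-term-nonNeg x) e)

    ∑-⟪⟫ : ∀ {K} (c : Fin K → ℤ) (x y : Fin K → Fin L → ℤ) →
             ∑[ e < L ] (W e * ∑[ k < K ] (c k * x k e * y k e)) ≡ ∑[ k < K ] (c k * ⟪ x k , y k ⟫)
    ∑-⟪⟫ {K} c x y = begin
      ∑[ e < L ] (W e * ∑[ k < K ] (c k * x k e * y k e))   ≡⟨ sum-cong-≗ (λ e → *-distribˡ-sum (W e) (λ k → c k * x k e * y k e)) ⟩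
      ∑[ e < L ] ∑[ k < K ] (W e * (c k * x k e * y k e))   ≡⟨ ∑-comm (λ e k → W e * (c k * x k e * y k e)) ⟩
      ∑[ k < K ] ∑[ e < L ] (W e * (c k * x k e * y k e))   ≡⟨ sum-cong-≗ (λ k → sum-cong-≗ λ e → pull (W e) (c k) (x k e) (y k e)) ⟩
      ∑[ k < K ] ∑[ e < L ] (c k * (W e * x k e * y k e))   ≡⟨ sum-cong-≗ (λ k → *-distribˡ-sum (c k) (λ e → W e * x k e * y k e)) ⟨
      ∑[ k < K ] (c k * ⟪ x k , y k ⟫)                     ∎
      where
      open ≡-Reasoning
      pull : ∀ w c a b → w * (c * a * b) ≡ c * (w * a * b)
      pull = solve-∀

    module Orthogonal {K} (v : Fin K → Fin L → ℤ) (orth : ∀ {k l} → k ≢ l → ⟪ v k , v l ⟫ ≡ 0ℤ) where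

      combination : (Fin K → ℤ) → Fin L → ℤ
      combination c e = ∑[ k < K ] (c k * v k e)

      combination-linear : ∀ c y → ⟪ combination c , y ⟫ ≡ ∑[ k < K ] (c k * ⟪ v k , y ⟫)
      combination-linear c y = begin
        ∑[ e < L ] (W e * combination c e * y e)             ≡⟨ sum-cong-≗ (λ e → push (W e) (combination c e) (y e)) ⟩
        ∑[ e < L ] (W e * (combination c e * y e))           ≡⟨ sum-cong-≗ (λ e → cong (W e *_) (*-distribʳ-sum (y e) (λ k → c k * v k e))) ⟩
        ∑[ e < L ] (W e * ∑[ k < K ] (c k * v k e * y e))   ≡⟨ ∑-⟪⟫ c v (λ _ → y) ⟩
        ∑[ k < K ] (c k * ⟪ v k , y ⟫)                       ∎
        where
        open ≡-Reasoning
        push : ∀ w a b → w * a * b ≡ w * (a * b)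
        push = solve-∀

      pythagoras : ∀ c → ⟪ combination c , combination c ⟫ ≡ ∑[ k < K ] (c k * c k * ⟪ v k , v k ⟫)
      pythagoras c = begin
        ⟪ combination c , combination c ⟫                          ≡⟨ combination-linear c _ ⟩
        ∑[ k < K ] (c k * ⟪ v k , combination c ⟫)                 ≡⟨ sum-cong-≗ (λ k → cong (c k *_) (coefficient k)) ⟩
        ∑[ k < K ] (c k * (c k * ⟪ v k , v k ⟫))                   ≡⟨ sum-cong-≗ (λ k → ℤP.*-assoc (c k) (c k) _) ⟨
        ∑[ k < K ] (c k * c k * ⟪ v k , v k ⟫)                     ∎
        where
        open ≡-Reasoning
        coefficient : ∀ k → ⟪ v k , combination c ⟫ ≡ c k * ⟪ v k , v k ⟫
        coefficient k = begin
          ⟪ v k , combination c ⟫                 ≡⟨ ⟪⟫-comm (v k) _ ⟩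
          ⟪ combination c , v k ⟫                 ≡⟨ combination-linear c (v k) ⟩
          ∑[ l < K ] (c l * ⟪ v l , v k ⟫)        ≡⟨ sum-single _ k (λ l l≢k → trans (cong (c l *_) (orth l≢k)) (ℤP.*-zeroʳ (c l))) ⟩
          c k * ⟪ v k , v k ⟫                     ∎

    -- Linear independence without division: with N_k = ⟪ v k , v k ⟫, P = ∏ N_k and q_k = P / N_k,
    -- y = ∑_k q_k v_k(e) v_k satisfies ⟪ y , y ⟫ = P · y(e) by Pythagoras, hence W_e · y(e) ≤ P;
    -- summing over e gives K · P ≤ L · P.
    orthogonal-family-size≤dim : ∀ {K} (v : Fin K → Fin L → ℤ) →
      (∀ k → 0ℤ < ⟪ v k , v k ⟫) → (∀ {k l} → k ≢ l → ⟪ v k , v l ⟫ ≡ 0ℤ) → K ℕ.≤ L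
    orthogonal-family-size≤dim {zero}  _ _         _    = z≤n
    orthogonal-family-size≤dim {suc K} v ⟪vk,vk⟫>0 orth =
      ℤP.drop‿+≤+ (ℤP.*-cancelʳ-≤-pos (+ suc K) (+ L) P {{ℤ.positive P>0}} (begin
        + suc K * P                  ≡⟨ sum-const (suc K) P ⟨
        ∑[ k < suc K ] P             ≡⟨ sum-cong-≗ (λ k → trans (P≡Nq k) (ℤP.*-comm (N k) (q k))) ⟩
        ∑[ k < suc K ] (q k * N k)   ≡⟨ ∑-⟪⟫ q v v ⟨
        ∑[ e < L ] (W e * τ e)       ≤⟨ sum-mono-≤ (λ e → *-cancelʳ-square (W e) (ℤP.<⇒≤ P>0) (τ≥0 e) (Wτ²≤Pτ e)) ⟩
        ∑[ e < L ] P                 ≡⟨ sum-const L P ⟩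
        + L * P                      ∎))
      where
      open Orthogonal v orth
      open ℤP.≤-Reasoning

      N : Fin (suc K) → ℤ
      N k = ⟪ v k , v k ⟫

      P : ℤ
      P = product N

      P>0 : 0ℤ < P
      P>0 = product-pos ⟪vk,vk⟫>0

      q : Fin (suc K) → ℤ
      q k = product (Vector.removeAt N k)

      P≡Nq : ∀ k → P ≡ N k * q k
      P≡Nq k = product-remove N

      τ : Fin L → ℤ
      τ e = ∑[ k < suc K ] (q k * v k e * v k e)

      τ≥0 : ∀ e → 0ℤ ≤ τ e
      τ≥0 e = sum-nonNeg λ k → subst (0ℤ ≤_) (sym (ℤP.*-assoc (q k) (v k e) (v k e)))
        (*-nonNeg (ℤP.<⇒≤ (product-pos (⟪vk,vk⟫>0 ∘ punchIn k))) (square-nonNeg (v k e)))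

      Wτ²≤Pτ : ∀ e → W e * τ e * τ e ≤ P * τ e
      Wτ²≤Pτ e = begin
        W e * τ e * τ e                              ≤⟨ term≤sum (⟪x,x⟫-term-nonNeg y) e ⟩
        ⟪ y , y ⟫                                    ≡⟨ pythagoras c ⟩
        ∑[ k < suc K ] (c k * c k * N k)             ≡⟨ sum-cong-≗ rescale ⟩
        ∑[ k < suc K ] (P * (q k * v k e * v k e))   ≡⟨ *-distribˡ-sum P (λ k → q k * v k e * v k e) ⟨
        P * τ e                                      ∎
        where
        c : Fin (suc K) → ℤ
        c k = q k * v k e
        y : Fin L → ℤ
        y = combination c
        regroup : ∀ q a n → q * a * (q * a) * n ≡ n * q * (q * a * a)
        regroup = solve-∀
        rescale : ∀ k → c k * c k * N k ≡ P * (q k * v k e * v k e)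
        rescale k = trans (regroup (q k) (v k e) (N k)) (cong (_* (q k * v k e * v k e)) (sym (P≡Nq k)))

  ∑cube : ∀ {n} → (Vec Bool n → ℤ) → ℤ
  ∑cube {zero}  f = f []
  ∑cube {suc n} f = ∑cube (f ∘ (false ∷_)) + ∑cube (f ∘ (true ∷_))

  ∑cube-cong : ∀ {n} {f g : Vec Bool n → ℤ} → (∀ x → f x ≡ g x) → ∑cube f ≡ ∑cube g
  ∑cube-cong {zero}  f≡g = f≡g []
  ∑cube-cong {suc n} f≡g = cong₂ _+_ (∑cube-cong (f≡g ∘ (false ∷_))) (∑cube-cong (f≡g ∘ (true ∷_)))

  *-distribˡ-∑cube : ∀ {n} c (f : Vec Bool n → ℤ) → c * ∑cube f ≡ ∑cube (λ x → c * f x)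
  *-distribˡ-∑cube {zero}  c f = refl
  *-distribˡ-∑cube {suc n} c f = begin
    c * (∑cube (f ∘ (false ∷_)) + ∑cube (f ∘ (true ∷_)))
      ≡⟨ ℤP.*-distribˡ-+ c _ _ ⟩
    c * ∑cube (f ∘ (false ∷_)) + c * ∑cube (f ∘ (true ∷_))
      ≡⟨ cong₂ _+_ (*-distribˡ-∑cube c (f ∘ (false ∷_))) (*-distribˡ-∑cube c (f ∘ (true ∷_))) ⟩
    ∑cube (λ x → c * f (false ∷ x)) + ∑cube (λ x → c * f (true ∷ x))
      ∎
    where open ≡-Reasoning

  ∑cube-∑-comm : ∀ {n m} (f : Fin m → Vec Bool n → ℤ) →
                 ∑cube (λ x → ∑[ e < m ] f e x) ≡ ∑[ e < m ] ∑cube (f e)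
  ∑cube-∑-comm {zero}  f = refl
  ∑cube-∑-comm {suc n} f = begin
    ∑cube (λ x → ∑[ e < _ ] f e (false ∷ x)) + ∑cube (λ x → ∑[ e < _ ] f e (true ∷ x))
      ≡⟨ cong₂ _+_ (∑cube-∑-comm (λ e → f e ∘ (false ∷_))) (∑cube-∑-comm (λ e → f e ∘ (true ∷_))) ⟩
    ∑[ e < _ ] ∑cube (f e ∘ (false ∷_)) + ∑[ e < _ ] ∑cube (f e ∘ (true ∷_))
      ≡⟨ ∑-distrib-+ (λ e → ∑cube (f e ∘ (false ∷_))) (λ e → ∑cube (f e ∘ (true ∷_))) ⟨
    ∑[ e < _ ] ∑cube (f e) ∎
    where open ≡-Reasoning

  ∑cube-1 : ∀ n → ∑cube {n} (λ _ → 1ℤ) ≡ + (2 ℕ.^ n)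
  ∑cube-1 zero    = refl
  ∑cube-1 (suc n) = begin
    ∑cube {n} (λ _ → 1ℤ) + ∑cube {n} (λ _ → 1ℤ)   ≡⟨ cong₂ _+_ (∑cube-1 n) (∑cube-1 n) ⟩
    + (2 ℕ.^ n) + + (2 ℕ.^ n)                      ≡⟨ cong (λ k → + (2 ℕ.^ n ℕ.+ k)) (ℕP.+-identityʳ (2 ℕ.^ n)) ⟨
    + (2 ℕ.^ suc n)                                ∎
    where open ≡-Reasoning

  _^ᵇ_ : ℤ → Bool → ℤ
  y ^ᵇ false = 1ℤ
  y ^ᵇ true  = y

  monomial : ∀ {n} → Subset n → Vec ℤ n → ℤ
  monomial []      []       = 1ℤ
  monomial (b ∷ S) (y ∷ ys) = y ^ᵇ b * monomial S ys

  sign : Bool → ℤ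
  sign false = 1ℤ
  sign true  = ℤ.-1ℤ

  χ : ∀ {n} → Subset n → Vec Bool n → ℤ
  χ S x = monomial S (Vec.map sign x)

  ∑cube-χ-∷ : ∀ {n} b (S : Subset n) → ∑cube (χ (b ∷ S)) ≡ (1ℤ ^ᵇ b + ℤ.-1ℤ ^ᵇ b) * ∑cube (χ S)
  ∑cube-χ-∷ b S = begin
    ∑cube (λ x → 1ℤ ^ᵇ b * χ S x) + ∑cube (λ x → ℤ.-1ℤ ^ᵇ b * χ S x)
      ≡⟨ cong₂ _+_ (*-distribˡ-∑cube (1ℤ ^ᵇ b) (χ S)) (*-distribˡ-∑cube (ℤ.-1ℤ ^ᵇ b) (χ S)) ⟨
    1ℤ ^ᵇ b * ∑cube (χ S) + ℤ.-1ℤ ^ᵇ b * ∑cube (χ S)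
      ≡⟨ ℤP.*-distribʳ-+ (∑cube (χ S)) (1ℤ ^ᵇ b) (ℤ.-1ℤ ^ᵇ b) ⟨
    (1ℤ ^ᵇ b + ℤ.-1ℤ ^ᵇ b) * ∑cube (χ S)
      ∎
    where open ≡-Reasoning

  ∑cube-χ≡0 : ∀ {n} {S : Subset n} {j} → j Subset.∈ S → ∑cube (χ S) ≡ 0ℤ
  ∑cube-χ≡0 {S = _ ∷ S} Vec.here          = trans (∑cube-χ-∷ true S) (ℤP.*-zeroˡ (∑cube (χ S)))
  ∑cube-χ≡0 {S = b ∷ S} (Vec.there j∈S) =
    trans (∑cube-χ-∷ b S) (trans (cong ((1ℤ ^ᵇ b + ℤ.-1ℤ ^ᵇ b) *_) (∑cube-χ≡0 j∈S)) (ℤP.*-zeroʳ (1ℤ ^ᵇ b + ℤ.-1ℤ ^ᵇ b)))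

  monomial-⊥ : ∀ {n} (ys : Vec ℤ n) → monomial Subset.⊥ ys ≡ 1ℤ
  monomial-⊥ []       = refl
  monomial-⊥ (y ∷ ys) = trans (ℤP.*-identityˡ _) (monomial-⊥ ys)

  ∑cube-χ-⊥ : ∀ n → ∑cube (χ (Subset.⊥ {n})) ≡ + (2 ℕ.^ n)
  ∑cube-χ-⊥ n = trans (∑cube-cong {n} (monomial-⊥ ∘ Vec.map sign)) (∑cube-1 n)

  letterIndicator : Sym → Bool → ℤ
  letterIndicator star _     = 1ℤ
  letterIndicator s0   false = 1ℤ
  letterIndicator s0   true  = 0ℤ
  letterIndicator s1   false = 0ℤ
  letterIndicator s1   true  = 1ℤ

  letterVolume : Sym → ℤ
  letterVolume star = + 2
  letterVolume s0   = 1ℤ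
  letterVolume s1   = 1ℤ

  balance : Sym → ℤ
  balance star = 0ℤ
  balance s0   = 1ℤ
  balance s1   = ℤ.-1ℤ

  indicator : ∀ {n} → Word n → Vec Bool n → ℤ
  indicator []      []      = 1ℤ
  indicator (s ∷ u) (c ∷ x) = letterIndicator s c * indicator u x

  volume : ∀ {n} → Word n → ℤ
  volume []      = 1ℤ
  volume (s ∷ u) = letterVolume s * volume u

  χ-mean : ∀ {n} → Subset n → Word n → ℤ
  χ-mean S u = monomial S (Vec.map balance u)

  χ-mean-⊥ : ∀ {n} (u : Word n) → χ-mean Subset.⊥ u ≡ 1ℤ
  χ-mean-⊥ u = monomial-⊥ (Vec.map balance u)

  letter-∑χ : ∀ s b → letterIndicator s false * sign false ^ᵇ b + letterIndicator s true * sign true ^ᵇ b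
                      ≡ letterVolume s * balance s ^ᵇ b
  letter-∑χ star false = refl
  letter-∑χ star true  = refl
  letter-∑χ s0   false = refl
  letter-∑χ s0   true  = refl
  letter-∑χ s1   false = refl
  letter-∑χ s1   true  = refl

  ∑cube-indicator-χ : ∀ {n} (u : Word n) S → ∑cube (λ x → indicator u x * χ S x) ≡ volume u * χ-mean S u
  ∑cube-indicator-χ []      []      = refl
  ∑cube-indicator-χ (s ∷ u) (b ∷ S) = begin
    ∑cube (λ x → a false * indicator u x * (sign false ^ᵇ b * χ S x))
      + ∑cube (λ x → a true * indicator u x * (sign true ^ᵇ b * χ S x))
        ≡⟨ cong₂ _+_ (∑cube-cong (λ x → regroup (a false) (sign false ^ᵇ b) (indicator u x) (χ S x)))
                     (∑cube-cong (λ x → regroup (a true) (sign true ^ᵇ b) (indicator u x) (χ S x))) ⟩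
    ∑cube (λ x → c false * ∑box x) + ∑cube (λ x → c true * ∑box x)
        ≡⟨ cong₂ _+_ (*-distribˡ-∑cube (c false) ∑box) (*-distribˡ-∑cube (c true) ∑box) ⟨
    c false * ∑cube ∑box + c true * ∑cube ∑box
        ≡⟨ ℤP.*-distribʳ-+ (∑cube ∑box) (c false) (c true) ⟨
    (c false + c true) * ∑cube ∑box
        ≡⟨ cong₂ _*_ (letter-∑χ s b) (∑cube-indicator-χ u S) ⟩
    letterVolume s * balance s ^ᵇ b * (volume u * χ-mean S u)
        ≡⟨ regroup (letterVolume s) (volume u) (balance s ^ᵇ b) (χ-mean S u) ⟩
    letterVolume s * volume u * (balance s ^ᵇ b * χ-mean S u)
        ∎
    where
    open ≡-Reasoning
    a : Bool → ℤ
    a = letterIndicator s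
    c : Bool → ℤ
    c x = a x * sign x ^ᵇ b
    ∑box : Vec Bool _ → ℤ
    ∑box x = indicator u x * χ S x
    regroup : ∀ p q r t → p * r * (q * t) ≡ p * q * (r * t)
    regroup = solve-∀

  Contains : Sym → Bool → Set
  Contains s c = s ≡ star ⊎ s ≡ bitSym c

  letter-cases : ∀ s c → Contains s c ⊎ letterIndicator s c ≡ 0ℤ
  letter-cases star c     = inj₁ (inj₁ refl)
  letter-cases s0   false = inj₁ (inj₂ refl)
  letter-cases s0   true  = inj₂ refl
  letter-cases s1   false = inj₂ refl
  letter-cases s1   true  = inj₁ (inj₂ refl)

  letterIndicator-contains : ∀ {s c} → Contains s c → letterIndicator s c ≡ 1ℤ
  letterIndicator-contains {star}       _ = refl
  letterIndicator-contains {s0} {false} _ = refl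
  letterIndicator-contains {s1} {true}  _ = refl
  letterIndicator-contains {s0} {true}  (inj₁ ())
  letterIndicator-contains {s0} {true}  (inj₂ ())
  letterIndicator-contains {s1} {false} (inj₁ ())
  letterIndicator-contains {s1} {false} (inj₂ ())

  indicator-covers : ∀ {n} (u : Word n) x → Covers x u → indicator u x ≡ 1ℤ
  indicator-covers []      []      _   = refl
  indicator-covers (s ∷ u) (c ∷ x) x∈u =
    cong₂ _*_ (letterIndicator-contains (x∈u zero)) (indicator-covers u x (x∈u ∘ suc))

  indicator-cases : ∀ {n} (u : Word n) x → Covers x u ⊎ indicator u x ≡ 0ℤ
  indicator-cases []      []      = inj₁ λ ()
  indicator-cases (s ∷ u) (c ∷ x) with letter-cases s c | indicator-cases u x
  ... | inj₂ a≡0 | _          = inj₂ (trans (cong (_* indicator u x) a≡0) (ℤP.*-zeroˡ (indicator u x)))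
  ... | inj₁ c∈s | inj₂ i≡0   = inj₂ (trans (cong (letterIndicator s c *_) i≡0) (ℤP.*-zeroʳ (letterIndicator s c)))
  ... | inj₁ c∈s | inj₁ x∈u   = inj₁ λ where
    zero    → c∈s
    (suc j) → x∈u j

  ¬contains-s0-and-s1 : ∀ c → Contains s0 c → Contains s1 c → ⊥
  ¬contains-s0-and-s1 false _ (inj₁ ())
  ¬contains-s0-and-s1 false _ (inj₂ ())
  ¬contains-s0-and-s1 true (inj₁ ()) _
  ¬contains-s0-and-s1 true (inj₂ ()) _

  covers-at : ∀ {n} (x : Vec Bool n) (w : Word n) j {s} → lookup w j ≡ s → Covers x w → Contains s (lookup x j)
  covers-at x w j refl x∈w = x∈w j

  disjoint-¬covers : ∀ {n} (u v : Word n) x → DisjointInteriors u v → Covers x u → Covers x v → ⊥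
  disjoint-¬covers u v x (j , inj₁ (u≡0 , v≡1)) x∈u x∈v =
    ¬contains-s0-and-s1 (lookup x j) (covers-at x u j u≡0 x∈u) (covers-at x v j v≡1 x∈v)
  disjoint-¬covers u v x (j , inj₂ (u≡1 , v≡0)) x∈u x∈v =
    ¬contains-s0-and-s1 (lookup x j) (covers-at x v j v≡0 x∈v) (covers-at x u j u≡1 x∈u)

  ∑indicator≡1 : ∀ {n} {D : List (Word n)} x → AllPairs DisjointInteriors D → Any (Covers x) D →
                 ∑[ e < length D ] indicator (List.lookup D e) x ≡ 1ℤ
  ∑indicator≡1 {D = u ∷ D} x (u#D ∷ _) (here x∈u) =
    cong₂ _+_ (indicator-covers u x x∈u) (sum-zero λ e → outside {List.lookup D e} (All.lookup u#D (∈-lookup e)))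
    where
    outside : ∀ {v} → DisjointInteriors u v → indicator v x ≡ 0ℤ
    outside {v} u#v = [ (λ x∈v → ⊥-elim (disjoint-¬covers u v x u#v x∈u x∈v)) , id ]′ (indicator-cases v x)
  ∑indicator≡1 {D = u ∷ D} x (u#D ∷ D#) (there x∈D) =
    cong₂ _+_ outside (∑indicator≡1 x D# x∈D)
    where
    outside : indicator u x ≡ 0ℤ
    outside = [ (λ x∈u → ⊥-elim (All.lookupWith (λ {v} u#v x∈v → disjoint-¬covers u v x u#v x∈u x∈v) u#D x∈D)) , id ]′
                (indicator-cases u x)

  ∑cube-χ-tiling : ∀ {n} {D : List (Word n)} → AllPairs DisjointInteriors D → (∀ x → Any (Covers x) D) →
    ∀ S → ∑cube (χ S) ≡ ∑[ e < length D ] (volume (List.lookup D e) * χ-mean S (List.lookup D e))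
  ∑cube-χ-tiling {n} {D} D# covers S = begin
    ∑cube (χ S)
      ≡⟨ ∑cube-cong (λ x → trans (cong (λ z → z * χ S x) (∑indicator≡1 x D# (covers x))) (ℤP.*-identityˡ (χ S x))) ⟨
    ∑cube (λ x → (∑[ e < length D ] indicator (box e) x) * χ S x)
      ≡⟨ ∑cube-cong (λ x → *-distribʳ-sum (χ S x) (λ e → indicator (box e) x)) ⟩
    ∑cube (λ x → ∑[ e < length D ] (indicator (box e) x * χ S x))
      ≡⟨ ∑cube-∑-comm (λ e x → indicator (box e) x * χ S x) ⟩
    ∑[ e < length D ] ∑cube (λ x → indicator (box e) x * χ S x)
      ≡⟨ sum-cong-≗ (λ e → ∑cube-indicator-χ (box e) S) ⟩
    ∑[ e < length D ] (volume (box e) * χ-mean S (box e))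
      ∎
    where
    open ≡-Reasoning
    box : Fin (length D) → Word n
    box = List.lookup D

  letterVolume-nonStar : ∀ s → letterVolume s * + (2 ℕ.^ nonStar s) ≡ + 2
  letterVolume-nonStar star = refl
  letterVolume-nonStar s0   = refl
  letterVolume-nonStar s1   = refl

  volume-nonStarCount : ∀ {n} (u : Word n) → volume u * + (2 ℕ.^ nonStarCount (Vec.toList u)) ≡ + (2 ℕ.^ n)
  volume-nonStarCount []              = refl
  volume-nonStarCount {suc n} (s ∷ u) = begin
    letterVolume s * volume u * + (2 ℕ.^ (nonStar s ℕ.+ k))          ≡⟨ cong (letterVolume s * volume u *_) (pos-2^-+ (nonStar s) k) ⟩
    letterVolume s * volume u * (+ (2 ℕ.^ nonStar s) * + (2 ℕ.^ k))   ≡⟨ regroup (letterVolume s) (volume u) _ _ ⟩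
    letterVolume s * + (2 ℕ.^ nonStar s) * (volume u * + (2 ℕ.^ k))   ≡⟨ cong₂ _*_ (letterVolume-nonStar s) (volume-nonStarCount u) ⟩
    + 2 * + (2 ℕ.^ n)                                                  ≡⟨ ℤP.pos-* 2 (2 ℕ.^ n) ⟨
    + (2 ℕ.^ suc n)                                                    ∎
    where
    open ≡-Reasoning
    k : ℕ
    k = nonStarCount (Vec.toList u)
    pos-2^-+ : ∀ a b → + (2 ℕ.^ (a ℕ.+ b)) ≡ + (2 ℕ.^ a) * + (2 ℕ.^ b)
    pos-2^-+ a b = trans (cong +_ (ℕP.^-distribˡ-+-* 2 a b)) (ℤP.pos-* (2 ℕ.^ a) (2 ℕ.^ b))
    regroup : ∀ p q r t → p * q * (r * t) ≡ p * r * (q * t)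
    regroup = solve-∀

  volume-pos : ∀ {n} (u : Word n) → 0ℤ < volume u
  volume-pos []         = +<+ (s≤s z≤n)
  volume-pos (s ∷ u)    = *-pos (letterVolume-pos s) (volume-pos u)
    where
    letterVolume-pos : ∀ s → 0ℤ < letterVolume s
    letterVolume-pos star = +<+ (s≤s z≤n)
    letterVolume-pos s0   = +<+ (s≤s z≤n)
    letterVolume-pos s1   = +<+ (s≤s z≤n)

  tiling-length : ∀ {n d} {D : List (Word n)} → IsTiling n d D → length D ≡ 2 ℕ.^ d
  tiling-length {n} {d} {D} (dominoes , D# , covers) =
    ℕP.*-cancelʳ-≡ (length D) (2 ℕ.^ d) (2 ℕ.^ n) {{ℕP.m^n≢0 2 n}} (ℤP.+-injective (begin
      + (length D ℕ.* 2 ℕ.^ n)                          ≡⟨ ℤP.pos-* (length D) (2 ℕ.^ n) ⟩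
      + length D * + (2 ℕ.^ n)                           ≡⟨ sum-const (length D) _ ⟨
      ∑[ e < length D ] (+ (2 ℕ.^ n))                    ≡⟨ sum-cong-≗ (λ e → sym (volume-domino e)) ⟩
      ∑[ e < length D ] (volume (box e) * + (2 ℕ.^ d))   ≡⟨ *-distribʳ-sum (+ (2 ℕ.^ d)) (volume ∘ box) ⟨
      (∑[ e < length D ] volume (box e)) * + (2 ℕ.^ d)   ≡⟨ cong (λ z → z * + (2 ℕ.^ d)) total-volume ⟩
      + (2 ℕ.^ n) * + (2 ℕ.^ d)                          ≡⟨ ℤP.*-comm (+ (2 ℕ.^ n)) _ ⟩
      + (2 ℕ.^ d) * + (2 ℕ.^ n)                          ≡⟨ ℤP.pos-* (2 ℕ.^ d) (2 ℕ.^ n) ⟨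
      + (2 ℕ.^ d ℕ.* 2 ℕ.^ n)                            ∎))
    where
    open ≡-Reasoning
    box : Fin (length D) → Word n
    box = List.lookup D
    volume-domino : ∀ e → volume (box e) * + (2 ℕ.^ d) ≡ + (2 ℕ.^ n)
    volume-domino e = subst (λ k → volume (box e) * + (2 ℕ.^ k) ≡ _) (All.lookup dominoes (∈-lookup e)) (volume-nonStarCount (box e))
    total-volume : ∑[ e < length D ] volume (box e) ≡ + (2 ℕ.^ n)
    total-volume = begin
      ∑[ e < length D ] volume (box e)                             ≡⟨ sum-cong-≗ (λ e → volume-χ-mean-⊥ (box e)) ⟨
      ∑[ e < length D ] (volume (box e) * χ-mean Subset.⊥ (box e))  ≡⟨ ∑cube-χ-tiling D# covers Subset.⊥ ⟨
      ∑cube (χ (Subset.⊥ {n}))                                     ≡⟨ ∑cube-χ-⊥ n ⟩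
      + (2 ℕ.^ n)                                                  ∎
      where
      volume-χ-mean-⊥ : ∀ u → volume u * χ-mean Subset.⊥ u ≡ volume u
      volume-χ-mean-⊥ u = trans (cong (volume u *_) (χ-mean-⊥ u)) (ℤP.*-identityʳ (volume u))

  χ-mean-⁅⁆ : ∀ {n} j (u : Word n) → χ-mean ⁅ j ⁆ u ≡ balance (lookup u j)
  χ-mean-⁅⁆ zero    (s ∷ u) = trans (cong (balance s *_) (χ-mean-⊥ u)) (ℤP.*-identityʳ (balance s))
  χ-mean-⁅⁆ (suc j) (s ∷ u) = trans (ℤP.*-identityˡ _) (χ-mean-⁅⁆ j u)

  χ-mean-⁅⁆∪⁅⁆ : ∀ {n} {i j} → i ≢ j → (u : Word n) → χ-mean (⁅ i ⁆ ∪ ⁅ j ⁆) u ≡ balance (lookup u i) * balance (lookup u j)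
  χ-mean-⁅⁆∪⁅⁆ {i = zero}  {zero}  0≢0 _       = contradiction refl 0≢0
  χ-mean-⁅⁆∪⁅⁆ {i = zero}  {suc j} _   (s ∷ u) =
    cong (balance s *_) (trans (cong (λ S → χ-mean S u) (∪-identityˡ ⁅ j ⁆)) (χ-mean-⁅⁆ j u))
  χ-mean-⁅⁆∪⁅⁆ {i = suc i} {zero}  _   (s ∷ u) =
    trans (cong (balance s *_) (trans (cong (λ S → χ-mean S u) (∪-identityʳ ⁅ i ⁆)) (χ-mean-⁅⁆ i u))) (ℤP.*-comm (balance s) _)
  χ-mean-⁅⁆∪⁅⁆ {i = suc i} {suc j} i≢j (s ∷ u) = trans (ℤP.*-identityˡ _) (χ-mean-⁅⁆∪⁅⁆ (i≢j ∘ cong suc) u)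

  coordinate : ∀ {n} → Fin (suc n) → Word n → ℤ
  coordinate zero    u = 1ℤ
  coordinate (suc j) u = balance (lookup u j)

  coordinate-product : ∀ {n} {k l : Fin (suc n)} → k ≢ l →
    Σ (Subset n) λ S → Nonempty S × (∀ u → coordinate k u * coordinate l u ≡ χ-mean S u)
  coordinate-product {k = zero}  {zero}  0≢0 = contradiction refl 0≢0
  coordinate-product {k = zero}  {suc j} _   = ⁅ j ⁆ , (j , x∈⁅x⁆ j) , λ u → trans (ℤP.*-identityˡ _) (sym (χ-mean-⁅⁆ j u))
  coordinate-product {k = suc i} {zero}  _   = ⁅ i ⁆ , (i , x∈⁅x⁆ i) , λ u → trans (ℤP.*-identityʳ _) (sym (χ-mean-⁅⁆ i u))
  coordinate-product {k = suc i} {suc j} i≢j =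
    ⁅ i ⁆ ∪ ⁅ j ⁆ , (i , x∈p∪q⁺ (inj₁ (x∈⁅x⁆ i))) , λ u → sym (χ-mean-⁅⁆∪⁅⁆ (i≢j ∘ cong suc) u)

  balance-≢0 : ∀ {s} → s ≢ star → balance s ≢ 0ℤ
  balance-≢0 {star} s≢star = contradiction refl s≢star
  balance-≢0 {s0}   _      = λ ()
  balance-≢0 {s1}   _      = λ ()

  tiling-dimension : ∀ {n d} {D : List (Word n)} → IsTiling n d D → SplitsEveryCoordinate n D → suc n ℕ.≤ length D
  tiling-dimension {n} {d} {D} (_ , D# , covers) splits = orthogonal-family-size≤dim v ⟪v,v⟫>0 orthogonal
    where
    box : Fin (length D) → Word n
    box = List.lookup D

    open WeightedInnerProduct (volume ∘ box) (ℤP.<⇒≤ ∘ volume-pos ∘ box)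

    v : Fin (suc n) → Fin (length D) → ℤ
    v k e = coordinate k (box e)

    orthogonal : ∀ {k l} → k ≢ l → ⟪ v k , v l ⟫ ≡ 0ℤ
    orthogonal {k} {l} k≢l with coordinate-product k≢l
    ... | S , S≠∅ , vkvl≡χ-mean = begin
      ∑[ e < length D ] (volume (box e) * v k e * v l e)      ≡⟨ sum-cong-≗ (λ e → weight (box e)) ⟩
      ∑[ e < length D ] (volume (box e) * χ-mean S (box e))   ≡⟨ ∑cube-χ-tiling D# covers S ⟨
      ∑cube (χ S)                                             ≡⟨ ∑cube-χ≡0 (proj₂ S≠∅) ⟩
      0ℤ                                                      ∎
      where
      open ≡-Reasoning
      weight : ∀ u → volume u * coordinate k u * coordinate l u ≡ volume u * χ-mean S u
      weight u = trans (ℤP.*-assoc (volume u) (coordinate k u) (coordinate l u)) (cong (volume u *_) (vkvl≡χ-mean u))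

    v≢0 : ∀ k → ∃ λ e → v k e ≢ 0ℤ
    v≢0 zero    = Any.index (covers (Vec.replicate n false)) , λ ()
    v≢0 (suc j) = Any.index (splits j) , balance-≢0 (lookup-index (splits j))

    ⟪v,v⟫>0 : ∀ k → 0ℤ < ⟪ v k , v k ⟫
    ⟪v,v⟫>0 k = ⟪x,x⟫>0 (volume-pos ∘ box) (v k) (proj₁ (v≢0 k)) (proj₂ (v≢0 k))

open CharacterSums using (tiling-length; tiling-dimension)
open import Data.Nat using (_+_; _≤_; _<_; _^_; _∸_; _≤?_)

restrict-++ : ∀ {m n} (p : Fin (m + n) → Bool) (e : Word m) (u : Word n) →
              restrict p (e Vec.++ u) ≡ restrict (p ∘ (_↑ˡ n)) e List.++ restrict (p ∘ (m ↑ʳ_)) u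
restrict-++ p []      u = refl
restrict-++ p (s ∷ e) u with p zero
... | true  = cong (s ∷_) (restrict-++ (p ∘ suc) e u)
... | false = restrict-++ (p ∘ suc) e u

countSel-++ : ∀ m {n} (p : Fin (m + n) → Bool) → countSel p ≡ countSel (p ∘ (_↑ˡ n)) + countSel (p ∘ (m ↑ʳ_))
countSel-++ zero    p = refl
countSel-++ (suc m) {n} p =
  trans (cong (first +_) (countSel-++ m (p ∘ suc)))
        (sym (ℕP.+-assoc first (countSel (p ∘ suc ∘ (_↑ˡ n))) (countSel (p ∘ suc ∘ (m ↑ʳ_)))))
  where
  first : ℕ
  first = if p zero then 1 else 0

restrict-cong : ∀ {n} {p q : Fin n → Bool} → (∀ j → p j ≡ q j) → ∀ u → restrict p u ≡ restrict q u
restrict-cong {q = q} p≗q []      = refl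
restrict-cong {q = q} p≗q (s ∷ u) rewrite p≗q zero with q zero
... | true  = cong (s ∷_) (restrict-cong (p≗q ∘ suc) u)
... | false = restrict-cong (p≗q ∘ suc) u

countSel-cong : ∀ {n} {p q : Fin n → Bool} → (∀ j → p j ≡ q j) → countSel p ≡ countSel q
countSel-cong {zero}  p≗q = refl
countSel-cong {suc n} p≗q = cong₂ _+_ (cong (λ b → if b then 1 else 0) (p≗q zero)) (countSel-cong (p≗q ∘ suc))

restrict-none : ∀ {n} {p : Fin n → Bool} → (∀ j → p j ≡ false) → ∀ u → restrict p u ≡ []
restrict-none p≡false []      = refl
restrict-none p≡false (s ∷ u) rewrite p≡false zero = restrict-none (p≡false ∘ suc) u

countSel-none : ∀ {n} {p : Fin n → Bool} → (∀ j → p j ≡ false) → countSel p ≡ 0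
countSel-none {zero}  p≡false = refl
countSel-none {suc n} p≡false rewrite p≡false zero = countSel-none (p≡false ∘ suc)

restrict-all : ∀ {n} {p : Fin n → Bool} → (∀ j → p j ≡ true) → ∀ u → restrict p u ≡ toList u
restrict-all p≡true []      = refl
restrict-all p≡true (s ∷ u) rewrite p≡true zero = cong (s ∷_) (restrict-all (p≡true ∘ suc) u)

countSel-all : ∀ {n} {p : Fin n → Bool} → (∀ j → p j ≡ true) → countSel p ≡ n
countSel-all {zero}  p≡true = refl
countSel-all {suc n} p≡true rewrite p≡true zero = cong suc (countSel-all (p≡true ∘ suc))

nonStarCount-++ : ∀ xs ys → nonStarCount (xs List.++ ys) ≡ nonStarCount xs + nonStarCount ys
nonStarCount-++ []       ys = refl
nonStarCount-++ (s ∷ xs) ys = trans (cong (nonStar s +_) (nonStarCount-++ xs ys)) (sym (ℕP.+-assoc (nonStar s) _ _))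

nonStarCount-stars : ∀ m → nonStarCount (toList (Vec.replicate m star)) ≡ 0
nonStarCount-stars zero    = refl
nonStarCount-stars (suc m) = nonStarCount-stars m

stars-unique : ∀ {m} (w : List Sym) → length w ≡ m → nonStarCount w ≡ 0 → w ≡ toList (Vec.replicate m star)
stars-unique {zero}  []         _   _  = refl
stars-unique {suc m} (star ∷ w) len ns = cong (star ∷_) (stars-unique w (ℕP.suc-injective len) ns)

single : ∀ {m} → Fin m → Sym → Word m
single c δ = Vec.replicate _ star [ c ]≔ δ

lookup-single : ∀ {m} (c : Fin m) δ → lookup (single c δ) c ≡ δ
lookup-single c δ = VecP.lookup∘update c (Vec.replicate _ star) δ

lookup-single-≢ : ∀ {m} {c c′ : Fin m} δ → c′ ≢ c → lookup (single c δ) c′ ≡ star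
lookup-single-≢ {c′ = c′} δ c′≢c = trans (VecP.lookup∘update′ c′≢c (Vec.replicate _ star) δ) (VecP.lookup-replicate c′ star)

nonStarCount-single : ∀ {m} (c : Fin m) δ → nonStarCount (toList (single c δ)) ≡ nonStar δ
nonStarCount-single {suc m} zero    δ = trans (cong (nonStar δ +_) (nonStarCount-stars m)) (ℕP.+-identityʳ (nonStar δ))
nonStarCount-single {suc m} (suc c) δ = nonStarCount-single c δ

oneNonStarWord-single : ∀ {m} (c : Fin m) b → OneNonStarWord m (toList (single c (bitSym b)))
oneNonStarWord-single c b = VecP.length-toList (single c (bitSym b)) , trans (nonStarCount-single c (bitSym b)) (nonStar-bitSym b)
  where
  nonStar-bitSym : ∀ b → nonStar (bitSym b) ≡ 1
  nonStar-bitSym false = refl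
  nonStar-bitSym true  = refl

oneNonStarWord⇒single : ∀ {m} (w : List Sym) → OneNonStarWord m w → ∃ λ (c : Fin m) → ∃ λ b → w ≡ toList (single c (bitSym b))
oneNonStarWord⇒single {suc m} (star ∷ w) (len , ns) with oneNonStarWord⇒single w (ℕP.suc-injective len , ns)
... | c , b , w≡single = suc c , b , cong (star ∷_) w≡single
oneNonStarWord⇒single {suc m} (s0 ∷ w) (len , ns) =
  zero , false , cong (s0 ∷_) (stars-unique w (ℕP.suc-injective len) (ℕP.suc-injective ns))
oneNonStarWord⇒single {suc m} (s1 ∷ w) (len , ns) =
  zero , true , cong (s1 ∷_) (stars-unique w (ℕP.suc-injective len) (ℕP.suc-injective ns))

data SplitView (m n : ℕ) : Fin (m + n) → Set where
  left  : (c : Fin m) → SplitView m n (c ↑ˡ n)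
  right : (j : Fin n) → SplitView m n (m ↑ʳ j)

splitView : ∀ m {n} (j : Fin (m + n)) → SplitView m n j
splitView zero    j       = right j
splitView (suc m) zero    = left zero
splitView (suc m) (suc j) with splitView m j
... | left c  = left (suc c)
... | right j = right j

covers-++ : ∀ {m n} {xs : Vec Bool m} {ys : Vec Bool n} {e u} → Covers xs e → Covers ys u → Covers (xs Vec.++ ys) (e Vec.++ u)
covers-++ {xs = []}    {e = []}    _      ys∈u j       = ys∈u j
covers-++ {xs = _ ∷ _} {e = _ ∷ _} xs∈e   ys∈u zero    = xs∈e zero
covers-++ {xs = _ ∷ xs} {e = _ ∷ e} xs∈e ys∈u (suc j) = covers-++ {xs = xs} {e = e} (xs∈e ∘ suc) ys∈u j

covers-single : ∀ {m} (xs : Vec Bool m) c → Covers xs (single c (bitSym (lookup xs c)))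
covers-single xs c c′ with c′ Fin.≟ c
... | yes refl = inj₂ (lookup-single c _)
... | no c′≢c  = inj₁ (lookup-single-≢ _ c′≢c)

Opposite : Sym → Sym → Set
Opposite s t = (s ≡ s0 × t ≡ s1) ⊎ (s ≡ s1 × t ≡ s0)

disjoint-++ˡ : ∀ {m n} (e e′ : Word m) (u v : Word n) → DisjointInteriors e e′ → DisjointInteriors (e Vec.++ u) (e′ Vec.++ v)
disjoint-++ˡ e e′ u v (c , e#e′) =
  c ↑ˡ _ , subst₂ Opposite (sym (VecP.lookup-++ˡ e u c)) (sym (VecP.lookup-++ˡ e′ v c)) e#e′

disjoint-++ʳ : ∀ {m n} (e e′ : Word m) (u v : Word n) → DisjointInteriors u v → DisjointInteriors (e Vec.++ u) (e′ Vec.++ v)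
disjoint-++ʳ {m} e e′ u v (j , u#v) =
  m ↑ʳ j , subst₂ Opposite (sym (VecP.lookup-++ʳ e u j)) (sym (VecP.lookup-++ʳ e′ v j)) u#v

clamp : ∀ {m} → ℕ → Fin (suc m)
clamp         zero    = zero
clamp {zero}  (suc k) = zero
clamp {suc m} (suc k) = suc (clamp k)

clamp-toℕ : ∀ {m} (c : Fin (suc m)) → clamp (toℕ c) ≡ c
clamp-toℕ         zero    = refl
clamp-toℕ {suc m} (suc c) = cong suc (clamp-toℕ c)

Block : ∀ {n d} → List (Word n) → (Fin n → Maybe (Fin d)) → Fin d → Set
Block {n} D f i =
  let p = λ (j : Fin n) → inBlock (f j) i in
    (∃ λ (j : Fin n) → f j ≡ just i)
    × All (λ u → OneNonStarWord (countSel p) (restrict p u)) D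
    × ((w : List Sym) → OneNonStarWord (countSel p) w → ∃ λ u → u ∈ D × restrict p u ≡ w)

module Extension (m′ n : ℕ) where

  m : ℕ
  m = suc m′

  piece : ℕ → Bool → Word n → Word (m + n)
  piece k b u = single (clamp k) (bitSym b) Vec.++ u

  -- The k-th domino is labelled min k m′, so every label in Fin m occurs once the list has m members.
  extend : ℕ → List (Word n) → List (Word (m + n))
  extend k []       = []
  extend k (u ∷ us) = piece k false u ∷ piece k true u ∷ extend (suc k) us

  All-extend : ∀ {P : Word n → Set} {Q : Word (m + n) → Set} →
               (∀ k b u → P u → Q (piece k b u)) → ∀ k {us} → All P us → All Q (extend k us)
  All-extend P⇒Q k []                   = []
  All-extend P⇒Q k {u ∷ _} (pu ∷ pus) = P⇒Q k false u pu ∷ P⇒Q k true u pu ∷ All-extend P⇒Q (suc k) pus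

  Any-extend : ∀ {P : Word n → Set} {Q : Word (m + n) → Set} →
               (∀ k u → P u → ∃ λ b → Q (piece k b u)) → ∀ k {us} → Any P us → Any Q (extend k us)
  Any-extend P⇒Q k {u ∷ _} (here pu) with P⇒Q k u pu
  ... | false , q = here q
  ... | true  , q = there (here q)
  Any-extend P⇒Q k (there pus) = there (there (Any-extend P⇒Q (suc k) pus))

  ∈-extend : ∀ k (us : List (Word n)) i → i < length us → ∃ λ u → ∀ b → piece (k + i) b u ∈ extend k us
  ∈-extend k (u ∷ us) zero    _ = u , λ where
    false → here (cong (λ k → piece k false u) (ℕP.+-identityʳ k))
    true  → there (here (cong (λ k → piece k true u) (ℕP.+-identityʳ k)))
  ∈-extend k (u ∷ us) (suc i) (s≤s i<|us|) with ∈-extend (suc k) us i i<|us|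
  ... | v , v∈ = v , λ b → there (there (subst (λ j → piece j b v ∈ extend (suc k) us) (sym (ℕP.+-suc k i)) (v∈ b)))

  piece-∈ : ∀ {D : List (Word n)} → m ≤ length D → ∀ c → ∃ λ u → ∀ b → single c (bitSym b) Vec.++ u ∈ extend 0 D
  piece-∈ {D} m≤|D| c with ∈-extend 0 D (toℕ c) (ℕP.<-≤-trans (FinP.toℕ<n c) m≤|D|)
  ... | u , u∈ = u , λ b → subst (λ c → single c (bitSym b) Vec.++ u ∈ extend 0 D) (clamp-toℕ c) (u∈ b)

  piece-domino : ∀ {d} k b u → IsDomino n d u → IsDomino (m + n) (suc d) (piece k b u)
  piece-domino {d} k b u u-domino = begin
    nonStarCount (toList (e Vec.++ u))                  ≡⟨ cong nonStarCount (VecP.toList-++ e u) ⟩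
    nonStarCount (toList e List.++ toList u)            ≡⟨ nonStarCount-++ (toList e) (toList u) ⟩
    nonStarCount (toList e) + nonStarCount (toList u)   ≡⟨ cong₂ _+_ (proj₂ (oneNonStarWord-single (clamp k) b)) u-domino ⟩
    suc d                                               ∎
    where
    open ≡-Reasoning
    e : Word m
    e = single (clamp k) (bitSym b)

  extend-disjoint : ∀ k {us} → AllPairs DisjointInteriors us → AllPairs DisjointInteriors (extend k us)
  extend-disjoint k {[]}     []            = []
  extend-disjoint k {u ∷ us} (u#us ∷ us#) =
    (halves-disjoint ∷ All-extend (later-disjoint false) (suc k) u#us)
    ∷ All-extend (later-disjoint true) (suc k) u#us
    ∷ extend-disjoint (suc k) us#
    where
    halves-disjoint : DisjointInteriors (piece k false u) (piece k true u)
    halves-disjoint = disjoint-++ˡ (single (clamp k) s0) (single (clamp k) s1) u u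
      (clamp k , inj₁ (lookup-single (clamp k) s0 , lookup-single (clamp k) s1))
    later-disjoint : ∀ b k′ b′ v → DisjointInteriors u v → DisjointInteriors (piece k b u) (piece k′ b′ v)
    later-disjoint b k′ b′ v = disjoint-++ʳ (single (clamp k) (bitSym b)) (single (clamp k′) (bitSym b′)) u v

  extend-covers : ∀ {us} → (∀ y → Any (Covers y) us) → ∀ x → Any (Covers x) (extend 0 us)
  extend-covers covers x with Vec.splitAt m x
  ... | xs , ys , refl =
    Any-extend (λ k u ys∈u → lookup xs (clamp k) , covers-++ {xs = xs} {e = single (clamp k) _} {u} (covers-single xs (clamp k)) ys∈u)
      0 (covers ys)

  extend-tiling : ∀ {d D} → IsTiling n d D → IsTiling (m + n) (suc d) (extend 0 D)
  extend-tiling (dominoes , D# , covers) = All-extend piece-domino 0 dominoes , extend-disjoint 0 D# , extend-covers covers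

  module _ {d} (f′ : Fin n → Maybe (Fin d)) where

    extendPartition : Fin (m + n) → Maybe (Fin (suc d))
    extendPartition = const (just zero) Vector.++ (Maybe.map suc ∘ f′)

    extendPartition-left : ∀ c → extendPartition (c ↑ˡ n) ≡ just zero
    extendPartition-left = VectorP.lookup-++ˡ {m = m} (const (just zero)) (Maybe.map suc ∘ f′)

    extendPartition-right : ∀ j → extendPartition (m ↑ʳ j) ≡ Maybe.map suc (f′ j)
    extendPartition-right = VectorP.lookup-++ʳ {m = m} (const (just zero)) (Maybe.map suc ∘ f′)

    private
      p₀ : Fin (m + n) → Bool
      p₀ j = inBlock (extendPartition j) zero

      p₀-left : ∀ c → p₀ (c ↑ˡ n) ≡ true
      p₀-left c = cong (λ x → inBlock x zero) (extendPartition-left c)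

      p₀-right : ∀ j → p₀ (m ↑ʳ j) ≡ false
      p₀-right j rewrite extendPartition-right j with f′ j
      ... | nothing = refl
      ... | just _  = refl

      countSel-p₀ : countSel p₀ ≡ m
      countSel-p₀ = trans (countSel-++ m p₀) (trans (cong₂ _+_ (countSel-all p₀-left) (countSel-none p₀-right)) (ℕP.+-identityʳ m))

      restrict-p₀ : ∀ (e : Word m) u → restrict p₀ (e Vec.++ u) ≡ toList e
      restrict-p₀ e u = trans (restrict-++ p₀ e u)
        (trans (cong₂ List._++_ (restrict-all p₀-left e) (restrict-none p₀-right u)) (ListP.++-identityʳ (toList e)))

    newBlock : ∀ {D} → m ≤ length D → Block (extend 0 D) extendPartition zero
    newBlock {D} m≤|D| =
      (zero ↑ˡ n , extendPartition-left zero) ,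
      All-extend piece-one 0 (All.universal (λ _ → tt) D) ,
      onto
      where
      piece-one : ∀ k b u → ⊤ → OneNonStarWord (countSel p₀) (restrict p₀ (piece k b u))
      piece-one k b u _ = subst₂ OneNonStarWord (sym countSel-p₀) (sym (restrict-p₀ (single (clamp k) (bitSym b)) u))
        (oneNonStarWord-single (clamp k) b)
      onto : ∀ w → OneNonStarWord (countSel p₀) w → ∃ λ v → v ∈ extend 0 D × restrict p₀ v ≡ w
      onto w w-one with oneNonStarWord⇒single w (subst (λ k → OneNonStarWord k w) countSel-p₀ w-one)
      ... | c , b , refl with piece-∈ m≤|D| c
      ...   | u , u∈ = _ , u∈ b , restrict-p₀ (single c (bitSym b)) u

    module _ (i : Fin d) where
      private
        p′ : Fin n → Bool
        p′ j = inBlock (f′ j) i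

        pₛ : Fin (m + n) → Bool
        pₛ j = inBlock (extendPartition j) (suc i)

        pₛ-left : ∀ c → pₛ (c ↑ˡ n) ≡ false
        pₛ-left c = cong (λ x → inBlock x (suc i)) (extendPartition-left c)

        pₛ-right : ∀ j → pₛ (m ↑ʳ j) ≡ p′ j
        pₛ-right j rewrite extendPartition-right j with f′ j
        ... | nothing = refl
        ... | just _  = refl

        countSel-pₛ : countSel pₛ ≡ countSel p′
        countSel-pₛ = trans (countSel-++ m pₛ) (cong₂ _+_ (countSel-none pₛ-left) (countSel-cong pₛ-right))

        restrict-pₛ : ∀ (e : Word m) u → restrict pₛ (e Vec.++ u) ≡ restrict p′ u
        restrict-pₛ e u = trans (restrict-++ pₛ e u) (cong₂ List._++_ (restrict-none pₛ-left e) (restrict-cong pₛ-right u))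

      oldBlock : ∀ {D} → Block D f′ i → Block (extend 0 D) extendPartition (suc i)
      oldBlock {D} ((j , f′j≡i) , one′ , onto′) =
        (m ↑ʳ j , trans (extendPartition-right j) (cong (Maybe.map suc) f′j≡i)) ,
        All-extend (λ k b u → subst₂ OneNonStarWord (sym countSel-pₛ) (sym (restrict-pₛ (single (clamp k) (bitSym b)) u))) 0 one′ ,
        onto
        where
        onto : ∀ w → OneNonStarWord (countSel pₛ) w → ∃ λ v → v ∈ extend 0 D × restrict pₛ v ≡ w
        onto w w-one with onto′ w (subst (λ k → OneNonStarWord k w) countSel-pₛ w-one)
        ... | u , u∈D , u|≡w =
          find (Any-extend (λ k v v|≡w → false , trans (restrict-pₛ (single (clamp k) s0) v) v|≡w) 0 (lose u∈D u|≡w))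

    extend-β : ∀ {D} → (∀ j → f′ j ≡ nothing → All (λ u → lookup u j ≡ star) D) →
               ∀ j → extendPartition j ≡ nothing → All (λ u → lookup u j ≡ star) (extend 0 D)
    extend-β β′ j f≡nothing with splitView m j
    ... | left c   = contradiction (trans (sym (extendPartition-left c)) f≡nothing) λ ()
    ... | right j′ = All-extend (λ k b u uj′≡star → trans (VecP.lookup-++ʳ (single (clamp k) (bitSym b)) u j′) uj′≡star) 0
                       (β′ j′ (map-suc≡nothing (trans (sym (extendPartition-right j′)) f≡nothing)))
      where
      map-suc≡nothing : ∀ {x : Maybe (Fin d)} → Maybe.map suc x ≡ nothing → x ≡ nothing
      map-suc≡nothing {nothing} _ = refl

  extend-regular : ∀ {d D} → IsRegular n d D → m ≤ length D → IsRegular (m + n) (suc d) (extend 0 D)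
  extend-regular (f′ , blocks′ , β′) m≤|D| = extendPartition f′ , blocks , extend-β f′ β′
    where
    blocks : ∀ i → Block (extend 0 _) (extendPartition f′) i
    blocks zero    = newBlock f′ m≤|D|
    blocks (suc i) = oldBlock f′ i (blocks′ i)

  extend-splits : ∀ {D} → SplitsEveryCoordinate n D → m ≤ length D → SplitsEveryCoordinate (m + n) (extend 0 D)
  extend-splits splits m≤|D| j with splitView m j
  ... | left c with piece-∈ m≤|D| c
  ...   | u , u∈ = lose (u∈ false) λ eq → s0≢star (trans (sym (trans (VecP.lookup-++ˡ (single c s0) u c) (lookup-single c s0))) eq)
    where
    s0≢star : s0 ≢ star
    s0≢star ()
  extend-splits splits m≤|D| j | right j′ =
    Any-extend (λ k u uj′≢star → false , λ eq → uj′≢star (trans (sym (VecP.lookup-++ʳ (single (clamp k) s0) u j′)) eq))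
      0 (splits j′)

n<2^n : ∀ n → n < 2 ^ n
n<2^n zero    = s≤s z≤n
n<2^n (suc n) = ℕP.+-mono-≤ (ℕP.m^n>0 2 n) (subst (suc n ≤_) (sym (ℕP.+-identityʳ (2 ^ n))) (n<2^n n))

block-sizes : ∀ d n → d < n → n < 2 ^ suc d →
  ∃ λ m → ∃ λ n′ → n ≡ m + n′ × 0 < m × m ≤ 2 ^ d × d ≤ n′ × n′ < 2 ^ d
block-sizes d n d<n n<2^[1+d] with n ≤? d + 2 ^ d
... | yes n≤d+2^d =
  n ∸ d , d , sym (ℕP.m∸n+n≡m (ℕP.<⇒≤ d<n)) , ℕP.m<n⇒0<n∸m d<n , ℕP.m≤n+o⇒m∸n≤o n d n≤d+2^d ,
  ℕP.≤-refl , n<2^n d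
... | no  n≰d+2^d =
  2 ^ d , n ∸ 2 ^ d , sym (ℕP.m+[n∸m]≡n 2^d≤n) , ℕP.m^n>0 2 d , ℕP.≤-refl ,
  ℕP.m+n≤o⇒m≤o∸n d (ℕP.<⇒≤ d+2^d<n) ,
  ℕP.m<n+o⇒m∸n<o n (2 ^ d) {{ℕP.m^n≢0 2 d}} (subst (n <_) (cong (2 ^ d +_) (ℕP.+-identityʳ (2 ^ d))) n<2^[1+d])
  where
  d+2^d<n : d + 2 ^ d < n
  d+2^d<n = ℕP.≰⇒> n≰d+2^d
  2^d≤n : 2 ^ d ≤ n
  2^d≤n = ℕP.≤-trans (ℕP.m≤n+m (2 ^ d) d) (ℕP.<⇒≤ d+2^d<n)

regular-tiling-exists : ∀ d n → d ≤ n → n < 2 ^ d →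
  Σ (List (Word n)) λ D → IsTiling n d D × IsRegular n d D × SplitsEveryCoordinate n D
regular-tiling-exists zero    zero    _   _            =
  [] ∷ [] , ((refl ∷ []) , ([] ∷ []) , λ { [] → here λ () }) , ((λ ()) , (λ ()) , (λ ())) , λ ()
regular-tiling-exists zero    (suc n) _   (s≤s ())
regular-tiling-exists (suc d) n       d<n n<2^[1+d] with block-sizes d n d<n n<2^[1+d]
... | suc m′ , n′ , refl , _ , m≤2^d , d≤n′ , n′<2^d with regular-tiling-exists d n′ d≤n′ n′<2^d
...   | D , tiling , regular , splits =
  extend 0 D , extend-tiling tiling , extend-regular regular m≤|D| , extend-splits splits m≤|D|
  where
  open Extension m′ n′
  m≤|D| : suc m′ ≤ length D
  m≤|D| = subst (suc m′ ≤_) (sym (tiling-length tiling)) m≤2^d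

theorem2 : (n d : ℕ) → 1 ≤ d → d < n →
    (Σ (List (Word n)) (λ D → IsTiling n d D × IsRegular n d D × StarIrreducible n D))
      ⇔ (d + 1 ≤ n × n ≤ 2 ^ d ∸ 1)
theorem2 n d _ d<n = mk⇔ necessary sufficient
  where
  Tilings : Set
  Tilings = Σ (List (Word n)) (λ D → IsTiling n d D × IsRegular n d D × StarIrreducible n D)

  pred≡∸1 : ℕ.pred (2 ^ d) ≡ 2 ^ d ∸ 1
  pred≡∸1 = ℕP.pred[m∸n]≡m∸[1+n] (2 ^ d) 0

  necessary : Tilings → d + 1 ≤ n × n ≤ 2 ^ d ∸ 1
  necessary (D , tiling , _ , irreducible) = subst (_≤ n) (ℕP.+-comm 1 d) d<n , subst (n ≤_) pred≡∸1 (ℕP.<⇒≤pred n<2^d)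
    where
    n<2^d : n < 2 ^ d
    n<2^d = subst (n <_) (tiling-length tiling) (tiling-dimension tiling (starIrreducible⇒splits irreducible))

  sufficient : d + 1 ≤ n × n ≤ 2 ^ d ∸ 1 → Tilings
  sufficient (_ , n≤2^d∸1) =
    let D , tiling , regular , splits = regular-tiling-exists d n (ℕP.<⇒≤ d<n) n<2^d
    in D , tiling , regular , splits⇒starIrreducible splits
    where
    n<2^d : n < 2 ^ d
    n<2^d = ℕP.m≤pred[n]⇒suc[m]≤n {{ℕP.m^n≢0 2 d}} (subst (n ≤_) (sym pred≡∸1) n≤2^d∸1)
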